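{- For every integer $l\ge 1$, let $\mathbf{MAJ}_{2l+1}:\{0,1\}^{2l+1}\to\{0,1\}$ be the majority function. Then $$L(\mathbf{MAJ}_{2l+1}) \geq \frac{(l+1)^2}{1-\epsilon(l)}, \qquad \text{where } \epsilon(l) = \frac{l^2(l+1)}{6\binom{2l+1}{l}}.$$
   Context: $\mathbf{MAJ}_{2l+1}$ outputs $1$ iff the number of $1$'s among its $2l+1$ input bits is at least $l+1$, and $0$ otherwise. A formula is a binary tree whose leaves are labeled by literals (variables or negated variables) and whose internal nodes are labeled by $\wedge$ or $\vee$; its size is its number of leaves. $L(f)$ denotes the minimum size of a formula computing $f$. $\binom{n}{k}$ is the binomial coefficient. -}

module Defs where

open import Data.Nat using (ℕ; zero; suc; _+_; _*_; _≤_)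
open import Data.Nat.Combinatorics using (_C_)
open import Data.Bool using (Bool; true; false; not; _∧_; _∨_)
open import Data.Fin using (Fin)
open import Data.Vec using (Vec; lookup; count)
open import Data.Integer as ℤ using (ℤ; +_)
open import Relation.Binary.PropositionalEquality using (_≡_)
open import Relation.Nullary.Decidable using (does)
open import Data.Bool.Properties using () renaming (_≟_ to _≟ᵇ_)

data Formula (n : ℕ) : Set where
  pos  : Fin n → Formula n
  neg  : Fin n → Formula n
  and  : Formula n → Formula n → Formula n
  or   : Formula n → Formula n → Formula n

size : ∀ {n} → Formula n → ℕ
size (pos _)   = 1
size (neg _)   = 1
size (and f g) = size f + size g
size (or f g)  = size f + size g

eval : ∀ {n} → Formula n → Vec Bool n → Bool
eval (pos i)   x = lookup x i
eval (neg i)   x = not (lookup x i)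
eval (and f g) x = eval f x ∧ eval g x
eval (or f g)  x = eval f x ∨ eval g x

Computes : ∀ {n} → Formula n → (Vec Bool n → Bool) → Set
Computes F f = ∀ x → eval F x ≡ f x

ones : ∀ {n} → Vec Bool n → ℕ
ones = count (λ b → b ≟ᵇ true)

MAJ : (l : ℕ) → Vec Bool (suc (2 * l)) → Bool
MAJ l x = does (suc l Data.Nat.≤? ones x)
  where import Data.Nat

-- Khrapchenko's argument, sharpened by counting bad pairs.  Let A and B be the
-- inputs with l+1 and l ones, N = |A| = |B| = C(2l+1, l), and let F compute
-- MAJ.  Following the formula from the root (Karchmer–Wigderson) sends every
-- (x, y) ∈ A × B to a leaf whose variable separates x from y.  Each of the
-- N(l+1) cube edges between A and B therefore reaches a leaf labelled by its
-- own direction, and Cauchy–Schwarz over the leaves gives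
--   (N(l+1))² ≤ size F · Σ_ℓ m_ℓ²,
-- where m_ℓ counts the edges reaching ℓ.  By the rectangle property a pair of
-- edges reaching the same leaf is determined by its endpoints (x, y) ∈ A × B,
-- so Σ_ℓ m_ℓ² ≤ N² − #bad, a pair being bad when it does not arise this way.
-- Finally, if x ∈ A has a zero at r and ones at p ≠ q, the three pairs
-- (x, x⊕r⊕p⊕q), (x⊕r⊕q, x⊕p), (x⊕r⊕p, x⊕q) cannot all be good.  There are
-- N(l+1)l² such configurations and each bad pair lies in at most six of them,
-- so #bad ≥ N l²(l+1)/6, which is the bound.

module Submission where

open import Defs
open import Data.Nat using (ℕ; zero; suc; _+_; _*_; _∸_; _≤_; _<_; z≤n; s≤s; NonZero; >-nonZero)
open import Data.Nat.Properties hiding (_≟_)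
import Data.Nat as ℕ
open import Data.Nat.Combinatorics using (_C_; nCk+nC[k+1]≡[n+1]C[k+1]; nCk≡nC[n∸k])
open import Data.Nat.Tactic.RingSolver using (solve-∀)
open import Data.Integer using (+_; _-_; +≤+) renaming (_*_ to _*ℤ_; _≤_ to _≤ℤ_)
open import Data.Integer.Properties using ([+m]-[+n]≡m⊖n; ⊖-≥; pos-*)
open import Data.Bool using (Bool; true; false; not; _∧_; if_then_else_)
open import Data.Bool.Properties using (not-involutive)
open import Data.Empty using (⊥; ⊥-elim)
open import Data.Fin using (Fin; zero; suc; _↑ˡ_; _↑ʳ_; splitAt)
open import Data.Fin.Properties using (_≟_; ↑ˡ-injective; ↑ʳ-injective; splitAt-↑ˡ; splitAt-↑ʳ)
open import Data.Vec using (Vec; []; _∷_; _++_; lookup; updateAt)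
open import Data.Vec.Properties
  using (lookup-++ˡ; lookup-++ʳ; lookup∘updateAt; lookup∘updateAt′; updateAt-updateAt; updateAt-id-local; updateAt-commutes)
open import Data.Product using (_,_; _×_)
open import Data.Sum using (_⊎_; inj₁; inj₂)
open import Function using (_∘_)
open import Relation.Binary.PropositionalEquality
open import Relation.Nullary using (Dec; does; yes; no)
open import Relation.Nullary.Decidable using (dec-true; dec-false)
open import Algebra.Properties.CommutativeSemigroup +-commutativeSemigroup using (interchange)
open import Algebra.Properties.Semiring.Sum +-*-semiring
  using (sum; sum-syntax; ∑-distrib-+; ∑-comm; *-distribˡ-sum; *-distribʳ-sum; sum-cong-≗; sum-replicate-zero)

infixr 11 𝟙[_]·_

𝟙[_]·_ : Bool → ℕ → ℕ
𝟙[ true  ]· m = m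
𝟙[ false ]· m = 0

𝟙 : Bool → ℕ
𝟙 b = 𝟙[ b ]· 1

𝟙[]·-≤ : ∀ b m → 𝟙[ b ]· m ≤ m
𝟙[]·-≤ true  m = ≤-refl
𝟙[]·-≤ false m = z≤n

𝟙[]·≡𝟙* : ∀ b m → 𝟙[ b ]· m ≡ 𝟙 b * m
𝟙[]·≡𝟙* true  m = sym (*-identityˡ m)
𝟙[]·≡𝟙* false m = refl

𝟙[]·-cong : ∀ b {m m′} → (b ≡ true → m ≡ m′) → 𝟙[ b ]· m ≡ 𝟙[ b ]· m′
𝟙[]·-cong true  m≡m′ = m≡m′ refl
𝟙[]·-cong false m≡m′ = refl

𝟙[]·-distrib-+ : ∀ b m n → 𝟙[ b ]· (m + n) ≡ 𝟙[ b ]· m + 𝟙[ b ]· n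
𝟙[]·-distrib-+ true  m n = refl
𝟙[]·-distrib-+ false m n = refl

at-least-one-false : ∀ {a b c} → (a ≡ true → b ≡ true → c ≡ true → ⊥) →
  1 ≤ 𝟙 (not a) + 𝟙 (not b) + 𝟙 (not c)
at-least-one-false {true}  {true}  {true}  all-true = ⊥-elim (all-true refl refl refl)
at-least-one-false {true}  {true}  {false} _        = s≤s z≤n
at-least-one-false {true}  {false} _                = s≤s z≤n
at-least-one-false {false} _                        = s≤s z≤n

∧-intro : ∀ {a b} → a ≡ true → b ≡ true → a ∧ b ≡ true
∧-intro refl refl = refl

from-does : ∀ {p} {P : Set p} (d : Dec P) → does d ≡ true → P
from-does (yes p) _ = p

∑-mono-≤ : ∀ {n} {f g : Fin n → ℕ} → (∀ i → f i ≤ g i) → sum f ≤ sum g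
∑-mono-≤ {zero}  f≤g = z≤n
∑-mono-≤ {suc n} f≤g = +-mono-≤ (f≤g zero) (∑-mono-≤ (f≤g ∘ suc))

∑-guard : ∀ {n} b (f : Fin n → ℕ) → ∑[ i < n ] 𝟙[ b ]· f i ≡ 𝟙[ b ]· sum f
∑-guard     true  f = refl
∑-guard {n} false f = sum-replicate-zero n

∑-𝟙[]·-distrib-+ : ∀ {n} (b : Fin n → Bool) (f g : Fin n → ℕ) →
  ∑[ i < n ] 𝟙[ b i ]· (f i + g i) ≡ ∑[ i < n ] 𝟙[ b i ]· f i + ∑[ i < n ] 𝟙[ b i ]· g i
∑-𝟙[]·-distrib-+ b f g = trans (sum-cong-≗ (λ i → 𝟙[]·-distrib-+ (b i) (f i) (g i)))
  (∑-distrib-+ (λ i → 𝟙[ b i ]· f i) (λ i → 𝟙[ b i ]· g i))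

∑-𝟙[]·-const : ∀ {n} (b : Fin n → Bool) m → ∑[ i < n ] 𝟙[ b i ]· m ≡ (∑[ i < n ] 𝟙 (b i)) * m
∑-𝟙[]·-const b m = trans (sum-cong-≗ (λ i → 𝟙[]·≡𝟙* (b i) m)) (sym (*-distribʳ-sum m (𝟙 ∘ b)))

∑-delta : ∀ {n} (i : Fin n) (f : Fin n → ℕ) → ∑[ j < n ] 𝟙[ does (i ≟ j) ]· f j ≡ f i
∑-delta {suc n} zero    f = trans (cong (_+_ (f zero)) (sum-replicate-zero n)) (+-identityʳ (f zero))
∑-delta         (suc i) f = ∑-delta i (f ∘ suc)

∑-split-at : ∀ {n} i (f : Fin n → ℕ) → sum f ≡ f i + ∑[ j < n ] 𝟙[ not (does (i ≟ j)) ]· f j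
∑-split-at {n} i f = begin
  sum f
    ≡⟨ sum-cong-≗ split ⟩
  ∑[ j < n ] (𝟙[ does (i ≟ j) ]· f j + 𝟙[ not (does (i ≟ j)) ]· f j)
    ≡⟨ ∑-distrib-+ (λ j → 𝟙[ does (i ≟ j) ]· f j) _ ⟩
  ∑[ j < n ] 𝟙[ does (i ≟ j) ]· f j + ∑[ j < n ] 𝟙[ not (does (i ≟ j)) ]· f j
    ≡⟨ cong (_+ ∑[ j < n ] 𝟙[ not (does (i ≟ j)) ]· f j) (∑-delta i f) ⟩
  f i + ∑[ j < n ] 𝟙[ not (does (i ≟ j)) ]· f j ∎
  where
  open ≡-Reasoning
  split : ∀ j → f j ≡ 𝟙[ does (i ≟ j) ]· f j + 𝟙[ not (does (i ≟ j)) ]· f j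
  split j with does (i ≟ j)
  ... | true  = sym (+-identityʳ (f j))
  ... | false = refl

∑-* : ∀ {m n} (f : Fin m → ℕ) (g : Fin n → ℕ) → sum f * sum g ≡ ∑[ i < m ] ∑[ j < n ] (f i * g j)
∑-* f g = trans (*-distribʳ-sum (sum g) f) (sum-cong-≗ (λ i → *-distribˡ-sum (f i) g))

∑³ : ∀ {n} → (Fin n → Fin n → Fin n → ℕ) → ℕ
∑³ {n} f = ∑[ a < n ] ∑[ b < n ] ∑[ c < n ] f a b c

∑³-cong : ∀ {n} {f g : Fin n → Fin n → Fin n → ℕ} → (∀ a b c → f a b c ≡ g a b c) → ∑³ f ≡ ∑³ g
∑³-cong f≡g = sum-cong-≗ (λ a → sum-cong-≗ (λ b → sum-cong-≗ (f≡g a b)))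

∑³-mono-≤ : ∀ {n} {f g : Fin n → Fin n → Fin n → ℕ} → (∀ a b c → f a b c ≤ g a b c) → ∑³ f ≤ ∑³ g
∑³-mono-≤ f≤g = ∑-mono-≤ (λ a → ∑-mono-≤ (λ b → ∑-mono-≤ (f≤g a b)))

∑³-distrib-+ : ∀ {n} (f g : Fin n → Fin n → Fin n → ℕ) → ∑³ (λ a b c → f a b c + g a b c) ≡ ∑³ f + ∑³ g
∑³-distrib-+ {n} f g = trans
  (sum-cong-≗ (λ a → trans (sum-cong-≗ (λ b → ∑-distrib-+ (f a b) (g a b)))
                           (∑-distrib-+ (λ b → sum (f a b)) (λ b → sum (g a b)))))
  (∑-distrib-+ (λ a → ∑[ b < n ] ∑[ c < n ] f a b c) _)

𝟙[]·-∑³ : ∀ {n} b (f : Fin n → Fin n → Fin n → ℕ) →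
  𝟙[ b ]· ∑³ f ≡ ∑³ (λ a b′ c → 𝟙[ b ]· f a b′ c)
𝟙[]·-∑³     true  f = refl
𝟙[]·-∑³ {n} false f = sym (trans (sum-cong-≗ {n} (λ a → trans (sum-cong-≗ {n} (λ b → sum-replicate-zero n))
  (sum-replicate-zero n))) (sum-replicate-zero n))

∑³-rotate : ∀ {n} (f : Fin n → Fin n → Fin n → ℕ) → ∑³ f ≡ ∑³ (λ c a b → f a b c)
∑³-rotate {n} f = trans (sum-cong-≗ (λ a → ∑-comm (f a))) (∑-comm (λ a c → ∑[ b < n ] f a b c))

2mn≤m²+n²-ordered : ∀ {m n} → m ≤ n → 2 * (m * n) ≤ m * m + n * n
2mn≤m²+n²-ordered {m} m≤n with d , refl ← m≤n⇒∃[o]m+o≡n m≤n =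
  subst (2 * (m * (m + d)) ≤_) (expand m d) (m≤m+n _ (d * d))
  where
  expand : ∀ m d → 2 * (m * (m + d)) + d * d ≡ m * m + (m + d) * (m + d)
  expand = solve-∀

2mn≤m²+n² : ∀ m n → 2 * (m * n) ≤ m * m + n * n
2mn≤m²+n² m n with ≤-total m n
... | inj₁ m≤n = 2mn≤m²+n²-ordered m≤n
... | inj₂ n≤m = subst₂ _≤_ (cong (2 *_) (*-comm n m)) (+-comm (n * n) (m * m)) (2mn≤m²+n²-ordered n≤m)

2as≤ma²+q : ∀ a s q m → s * s ≤ m * q → 2 * (a * s) ≤ m * (a * a) + q
2as≤ma²+q a zero    q zero    _     rewrite *-zeroʳ a = z≤n
2as≤ma²+q a (suc s) q zero    ()
2as≤ma²+q a s       q (suc k) s²≤mq = *-cancelˡ-≤ (suc k) (begin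
  suc k * (2 * (a * s))                 ≡⟨ scale (suc k) a s ⟩
  2 * ((suc k * a) * s)                 ≤⟨ 2mn≤m²+n² (suc k * a) s ⟩
  (suc k * a) * (suc k * a) + s * s     ≤⟨ +-monoʳ-≤ _ s²≤mq ⟩
  (suc k * a) * (suc k * a) + suc k * q ≡⟨ factor (suc k) a q ⟩
  suc k * (suc k * (a * a) + q)         ∎)
  where
  open ≤-Reasoning
  scale : ∀ m a s → m * (2 * (a * s)) ≡ 2 * ((m * a) * s)
  scale = solve-∀
  factor : ∀ m a q → (m * a) * (m * a) + m * q ≡ m * (m * (a * a) + q)
  factor = solve-∀

∑²≤n*∑² : ∀ {n} (f : Fin n → ℕ) → sum f * sum f ≤ n * ∑[ i < n ] (f i * f i)
∑²≤n*∑² {zero}  f = z≤n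
∑²≤n*∑² {suc n} f = step (f zero) _ _ (∑²≤n*∑² (f ∘ suc))
  where
  step : ∀ a s q → s * s ≤ n * q → (a + s) * (a + s) ≤ suc n * (a * a + q)
  step a s q s²≤nq = begin
    (a + s) * (a + s)                 ≡⟨ square-sum a s ⟩
    a * a + 2 * (a * s) + s * s       ≤⟨ +-mono-≤ (+-monoʳ-≤ (a * a) (2as≤ma²+q a s q n s²≤nq)) s²≤nq ⟩
    a * a + (n * (a * a) + q) + n * q ≡⟨ regroup a q n ⟩
    suc n * (a * a + q)               ∎
    where
    open ≤-Reasoning
    square-sum : ∀ a s → (a + s) * (a + s) ≡ a * a + 2 * (a * s) + s * s
    square-sum = solve-∀
    regroup : ∀ a q m → a * a + (m * (a * a) + q) + m * q ≡ suc m * (a * a + q)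
    regroup = solve-∀

-- Sums over the Boolean cube

cubeSum : ∀ n → (Vec Bool n → ℕ) → ℕ
cubeSum zero    f = f []
cubeSum (suc n) f = cubeSum n (f ∘ (false ∷_)) + cubeSum n (f ∘ (true ∷_))

infixl 10 cubeSum
syntax cubeSum n (λ x → e) = ∑[ x ∈𝔹^ n ] e

cubeSum-cong : ∀ {n} {f g : Vec Bool n → ℕ} → f ≗ g → cubeSum n f ≡ cubeSum n g
cubeSum-cong {zero}  f≗g = f≗g []
cubeSum-cong {suc n} f≗g = cong₂ _+_ (cubeSum-cong (f≗g ∘ (false ∷_))) (cubeSum-cong (f≗g ∘ (true ∷_)))

cubeSum-mono-≤ : ∀ {n} {f g : Vec Bool n → ℕ} → (∀ x → f x ≤ g x) → cubeSum n f ≤ cubeSum n g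
cubeSum-mono-≤ {zero}  f≤g = f≤g []
cubeSum-mono-≤ {suc n} f≤g = +-mono-≤ (cubeSum-mono-≤ (f≤g ∘ (false ∷_))) (cubeSum-mono-≤ (f≤g ∘ (true ∷_)))

cubeSum-point : ∀ {n} (f : Vec Bool n → ℕ) x → f x ≤ cubeSum n f
cubeSum-point f []          = ≤-refl
cubeSum-point f (false ∷ x) = ≤-trans (cubeSum-point (f ∘ (false ∷_)) x) (m≤m+n _ _)
cubeSum-point f (true  ∷ x) = ≤-trans (cubeSum-point (f ∘ (true ∷_)) x) (m≤n+m _ _)

cubeSum-distrib-+ : ∀ {n} (f g : Vec Bool n → ℕ) → ∑[ x ∈𝔹^ n ] (f x + g x) ≡ cubeSum n f + cubeSum n g
cubeSum-distrib-+ {zero}  f g = refl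
cubeSum-distrib-+ {suc n} f g = trans
  (cong₂ _+_ (cubeSum-distrib-+ (f ∘ (false ∷_)) (g ∘ (false ∷_)))
             (cubeSum-distrib-+ (f ∘ (true ∷_)) (g ∘ (true ∷_))))
  (interchange (cubeSum n (f ∘ (false ∷_))) _ _ _)

*-distribˡ-cubeSum : ∀ {n} m (f : Vec Bool n → ℕ) → m * cubeSum n f ≡ ∑[ x ∈𝔹^ n ] (m * f x)
*-distribˡ-cubeSum {zero}  m f = refl
*-distribˡ-cubeSum {suc n} m f = trans (*-distribˡ-+ m _ _)
  (cong₂ _+_ (*-distribˡ-cubeSum m (f ∘ (false ∷_))) (*-distribˡ-cubeSum m (f ∘ (true ∷_))))

*-distribʳ-cubeSum : ∀ {n} m (f : Vec Bool n → ℕ) → cubeSum n f * m ≡ ∑[ x ∈𝔹^ n ] (f x * m)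
*-distribʳ-cubeSum {n} m f = trans (*-comm (cubeSum n f) m)
  (trans (*-distribˡ-cubeSum m f) (cubeSum-cong (λ x → *-comm m (f x))))

cubeSum-* : ∀ {m n} (f : Vec Bool m → ℕ) (g : Vec Bool n → ℕ) →
  cubeSum m f * cubeSum n g ≡ ∑[ x ∈𝔹^ m ] ∑[ y ∈𝔹^ n ] (f x * g y)
cubeSum-* f g = trans (*-distribʳ-cubeSum _ f) (cubeSum-cong (λ x → *-distribˡ-cubeSum (f x) g))

∑-cubeSum-comm : ∀ {m n} (f : Fin m → Vec Bool n → ℕ) →
  ∑[ i < m ] ∑[ x ∈𝔹^ n ] f i x ≡ ∑[ x ∈𝔹^ n ] ∑[ i < m ] f i x
∑-cubeSum-comm {n = zero}  f = refl
∑-cubeSum-comm {n = suc n} f = trans (∑-distrib-+ (λ i → cubeSum n (f i ∘ (false ∷_))) _)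
  (cong₂ _+_ (∑-cubeSum-comm (λ i → f i ∘ (false ∷_))) (∑-cubeSum-comm (λ i → f i ∘ (true ∷_))))

cubeSum-∑³-comm : ∀ {n m} (f : Vec Bool n → Fin m → Fin m → Fin m → ℕ) →
  ∑[ x ∈𝔹^ n ] ∑³ (f x) ≡ ∑³ (λ a b c → ∑[ x ∈𝔹^ n ] f x a b c)
cubeSum-∑³-comm {n} {m} f = trans (sym (∑-cubeSum-comm (λ a x → ∑[ b < m ] ∑[ c < m ] f x a b c)))
  (sum-cong-≗ (λ a → trans (sym (∑-cubeSum-comm (λ b x → ∑[ c < m ] f x a b c)))
    (sum-cong-≗ (λ b → sym (∑-cubeSum-comm (λ c x → f x a b c))))))

cubeSum-∑³-distrib-+ : ∀ {n m} (f g : Vec Bool n → Fin m → Fin m → Fin m → ℕ) →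
  ∑[ x ∈𝔹^ n ] ∑³ (λ a b c → f x a b c + g x a b c) ≡ ∑[ x ∈𝔹^ n ] ∑³ (f x) + ∑[ x ∈𝔹^ n ] ∑³ (g x)
cubeSum-∑³-distrib-+ {n} f g = trans (cubeSum-cong {n} (λ x → ∑³-distrib-+ (f x) (g x)))
  (cubeSum-distrib-+ (λ x → ∑³ (f x)) (λ x → ∑³ (g x)))

cubeSum-∑-* : ∀ {n m} (f g : Vec Bool n → Fin m → ℕ) →
  (∑[ x ∈𝔹^ n ] ∑[ i < m ] f x i) * (∑[ y ∈𝔹^ n ] ∑[ j < m ] g y j)
    ≡ ∑[ x ∈𝔹^ n ] ∑[ y ∈𝔹^ n ] ∑[ i < m ] ∑[ j < m ] (f x i * g y j)
cubeSum-∑-* {n} f g = trans (cubeSum-* (sum ∘ f) (sum ∘ g))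
  (cubeSum-cong {n} (λ x → cubeSum-cong {n} (λ y → ∑-* (f x) (g y))))

-- Flips and levels of the cube

infixl 6 _⊕_

_⊕_ : ∀ {n} → Vec Bool n → Fin n → Vec Bool n
x ⊕ i = updateAt x i not

lookup-⊕ : ∀ {n} (x : Vec Bool n) i → lookup (x ⊕ i) i ≡ not (lookup x i)
lookup-⊕ x i = lookup∘updateAt i x

lookup-⊕-≢ : ∀ {n} (x : Vec Bool n) {i j} → i ≢ j → lookup (x ⊕ j) i ≡ lookup x i
lookup-⊕-≢ x {i} {j} i≢j = lookup∘updateAt′ i j i≢j x

⊕-involutive : ∀ {n} (x : Vec Bool n) i → x ⊕ i ⊕ i ≡ x
⊕-involutive x i = trans (updateAt-updateAt i x) (updateAt-id-local i x (not-involutive _))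

⊕-comm : ∀ {n} (x : Vec Bool n) i j → x ⊕ i ⊕ j ≡ x ⊕ j ⊕ i
⊕-comm x i j with i ≟ j
... | yes refl = refl
... | no  i≢j  = updateAt-commutes j i (i≢j ∘ sym) x

⊕-cancel-middle : ∀ {n} (x : Vec Bool n) i j → x ⊕ i ⊕ j ⊕ i ≡ x ⊕ j
⊕-cancel-middle x i j = trans (⊕-comm (x ⊕ i) j i) (cong (_⊕ j) (⊕-involutive x i))

cubeSum-⊕ : ∀ {n} (f : Vec Bool n → ℕ) i → ∑[ x ∈𝔹^ n ] f (x ⊕ i) ≡ cubeSum n f
cubeSum-⊕ {suc n} f zero    = +-comm (cubeSum n (f ∘ (true ∷_))) _
cubeSum-⊕ {suc n} f (suc i) = cong₂ _+_ (cubeSum-⊕ (f ∘ (false ∷_)) i) (cubeSum-⊕ (f ∘ (true ∷_)) i)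

cubeSum-∑-⊕ : ∀ {n} (f : Vec Bool n → Fin n → ℕ) →
  ∑[ x ∈𝔹^ n ] ∑[ j < n ] f x j ≡ ∑[ y ∈𝔹^ n ] ∑[ j < n ] f (y ⊕ j) j
cubeSum-∑-⊕ {n} f = begin
  ∑[ x ∈𝔹^ n ] ∑[ j < n ] f x j       ≡⟨ ∑-cubeSum-comm (λ j x → f x j) ⟨
  ∑[ j < n ] ∑[ x ∈𝔹^ n ] f x j       ≡⟨ sum-cong-≗ (λ j → cubeSum-⊕ (λ x → f x j) j) ⟨
  ∑[ j < n ] ∑[ y ∈𝔹^ n ] f (y ⊕ j) j ≡⟨ ∑-cubeSum-comm (λ j y → f (y ⊕ j) j) ⟩
  ∑[ y ∈𝔹^ n ] ∑[ j < n ] f (y ⊕ j) j ∎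
  where open ≡-Reasoning

ones-⊕-true : ∀ {n} (x : Vec Bool n) {i} → lookup x i ≡ true → suc (ones (x ⊕ i)) ≡ ones x
ones-⊕-true (true  ∷ x) {zero}  refl = refl
ones-⊕-true (false ∷ x) {suc i} xᵢ   = ones-⊕-true x xᵢ
ones-⊕-true (true  ∷ x) {suc i} xᵢ   = cong suc (ones-⊕-true x xᵢ)

ones-⊕-false : ∀ {n} (x : Vec Bool n) {i} → lookup x i ≡ false → ones (x ⊕ i) ≡ suc (ones x)
ones-⊕-false (false ∷ x) {zero}  refl = refl
ones-⊕-false (false ∷ x) {suc i} xᵢ   = ones-⊕-false x xᵢ
ones-⊕-false (true  ∷ x) {suc i} xᵢ   = cong suc (ones-⊕-false x xᵢ)

∑-ones : ∀ {n} (x : Vec Bool n) → ∑[ i < n ] 𝟙 (lookup x i) ≡ ones x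
∑-ones []          = refl
∑-ones (false ∷ x) = ∑-ones x
∑-ones (true  ∷ x) = cong suc (∑-ones x)

∑-zeros+ones : ∀ {n} (x : Vec Bool n) → ∑[ i < n ] 𝟙 (not (lookup x i)) + ones x ≡ n
∑-zeros+ones []          = refl
∑-zeros+ones (false ∷ x) = cong suc (∑-zeros+ones x)
∑-zeros+ones (true  ∷ x) = trans (+-suc _ _) (cong suc (∑-zeros+ones x))

atLevel : ∀ {n} → ℕ → Vec Bool n → Bool
atLevel k x = does (ones x ℕ.≟ k)

atLevel⇒ones≡ : ∀ {n k} (x : Vec Bool n) → atLevel k x ≡ true → ones x ≡ k
atLevel⇒ones≡ {k = k} x = from-does (ones x ℕ.≟ k)

ones≡⇒atLevel : ∀ {n k} (x : Vec Bool n) → ones x ≡ k → atLevel k x ≡ true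
ones≡⇒atLevel {k = k} x = dec-true (ones x ℕ.≟ k)

atLevel-⊕-true : ∀ {n k} (x : Vec Bool n) {i} → lookup x i ≡ true →
  atLevel (suc k) x ≡ true → atLevel k (x ⊕ i) ≡ true
atLevel-⊕-true x xᵢ at = ones≡⇒atLevel (x ⊕ _) (suc-injective (trans (ones-⊕-true x xᵢ) (atLevel⇒ones≡ x at)))

atLevel-⊕-false : ∀ {n k} (x : Vec Bool n) {i} → lookup x i ≡ false →
  atLevel k x ≡ true → atLevel (suc k) (x ⊕ i) ≡ true
atLevel-⊕-false x xᵢ at = ones≡⇒atLevel (x ⊕ _) (trans (ones-⊕-false x xᵢ) (cong suc (atLevel⇒ones≡ x at)))

levelSize : ℕ → ℕ → ℕ
levelSize n k = ∑[ x ∈𝔹^ n ] 𝟙 (atLevel k x)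

levelSize≡nCk : ∀ n k → levelSize n k ≡ n C k
levelSize≡nCk zero    zero    = refl
levelSize≡nCk zero    (suc k) = refl
levelSize≡nCk (suc n) zero    = cong₂ _+_ (levelSize≡nCk n zero) (nothing-below n)
  where
  nothing-below : ∀ n → ∑[ x ∈𝔹^ n ] 0 ≡ 0
  nothing-below zero    = refl
  nothing-below (suc n) = cong₂ _+_ (nothing-below n) (nothing-below n)
levelSize≡nCk (suc n) (suc k) = trans (cong₂ _+_ (levelSize≡nCk n (suc k)) (levelSize≡nCk n k))
  (trans (+-comm (n C suc k) (n C k)) (nCk+nC[k+1]≡[n+1]C[k+1] n k))

∑-flip-≤ : ∀ {n} (x : Vec Bool n) (b : Fin n → Bool) (h : Vec Bool n → ℕ) →
  ∑[ i < n ] 𝟙[ b i ]· h (x ⊕ i) ≤ cubeSum n h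
∑-flip-≤ x b h = ≤-trans (∑-mono-≤ (λ i → 𝟙[]·-≤ (b i) _)) (all-flips x h)
  where
  all-flips : ∀ {n} (x : Vec Bool n) h → ∑[ i < n ] h (x ⊕ i) ≤ cubeSum n h
  all-flips []          h = z≤n
  all-flips (false ∷ x) h = ≤-trans
    (+-mono-≤ (cubeSum-point (h ∘ (true ∷_)) x) (all-flips x (h ∘ (false ∷_))))
    (≤-reflexive (+-comm (cubeSum _ (h ∘ (true ∷_))) _))
  all-flips (true  ∷ x) h = +-mono-≤ (cubeSum-point (h ∘ (false ∷_)) x) (all-flips x (h ∘ (true ∷_)))

-- The subscripts are the values of x at the flipped coordinates.  Each guard
-- sits at the sum over its own index, so that splitting x = b ∷ x′ makes the
-- vanishing terms vanish definitionally.  Distinct patterns give distinct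
-- vectors, up to swapping p and q: hence the factors 2 below.

∑⊕₀₁ : ∀ {n} → Vec Bool n → (Vec Bool n → ℕ) → ℕ
∑⊕₀₁ {n} x h = ∑[ r < n ] 𝟙[ not (lookup x r) ]· (∑[ q < n ] 𝟙[ lookup x q ]· h (x ⊕ r ⊕ q))

∑⊕₁₁ : ∀ {n} → Vec Bool n → (Vec Bool n → ℕ) → ℕ
∑⊕₁₁ {n} x h =
  ∑[ p < n ] 𝟙[ lookup x p ]· (∑[ q < n ] 𝟙[ not (does (p ≟ q)) ]· 𝟙[ lookup x q ]· h (x ⊕ p ⊕ q))

∑⊕₀₁₁ : ∀ {n} → Vec Bool n → (Vec Bool n → ℕ) → ℕ
∑⊕₀₁₁ {n} x h = ∑[ r < n ] 𝟙[ not (lookup x r) ]·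
  (∑[ p < n ] 𝟙[ lookup x p ]· (∑[ q < n ] 𝟙[ not (does (p ≟ q)) ]· 𝟙[ lookup x q ]· h (x ⊕ r ⊕ p ⊕ q)))

∑⊕₀₁-≤ : ∀ {n} (x : Vec Bool n) h → ∑⊕₀₁ x h ≤ cubeSum n h
∑⊕₀₁-≤ []          h = z≤n
∑⊕₀₁-≤ (false ∷ x) h = ≤-trans
  (+-mono-≤ (∑-flip-≤ x (lookup x) (h ∘ (true ∷_))) (∑⊕₀₁-≤ x (h ∘ (false ∷_))))
  (≤-reflexive (+-comm (cubeSum _ (h ∘ (true ∷_))) _))
∑⊕₀₁-≤ (true  ∷ x) h = subst (_≤ cubeSum _ h) (sym (∑-𝟙[]·-distrib-+ (λ r → not (lookup x r)) _ _))
  (+-mono-≤ (∑-flip-≤ x (λ r → not (lookup x r)) (h ∘ (false ∷_))) (∑⊕₀₁-≤ x (h ∘ (true ∷_))))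

∑⊕₁₁-≤ : ∀ {n} (x : Vec Bool n) h → ∑⊕₁₁ x h ≤ 2 * cubeSum n h
∑⊕₁₁-≤ []          h = z≤n
∑⊕₁₁-≤ (false ∷ x) h =
  ≤-trans (∑⊕₁₁-≤ x (h ∘ (false ∷_))) (*-monoʳ-≤ 2 (m≤m+n (cubeSum _ (h ∘ (false ∷_))) _))
∑⊕₁₁-≤ {suc n} (true ∷ x) h = begin
  S₀ + ∑[ p < n ] 𝟙[ lookup x p ]· (h₀ (x ⊕ p) + _)
    ≡⟨ cong (_+_ S₀) (∑-𝟙[]·-distrib-+ (lookup x) _ _) ⟩
  S₀ + (S₀ + ∑⊕₁₁ x h₁)
    ≤⟨ +-mono-≤ S₀≤ (+-mono-≤ S₀≤ (∑⊕₁₁-≤ x h₁)) ⟩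
  cubeSum n h₀ + (cubeSum n h₀ + 2 * cubeSum n h₁)
    ≡⟨ double (cubeSum n h₀) (cubeSum n h₁) ⟩
  2 * (cubeSum n h₀ + cubeSum n h₁) ∎
  where
  open ≤-Reasoning
  h₀ h₁ : Vec Bool n → ℕ
  h₀ = h ∘ (false ∷_)
  h₁ = h ∘ (true ∷_)
  S₀ = ∑[ q < n ] 𝟙[ lookup x q ]· h₀ (x ⊕ q)
  S₀≤ : S₀ ≤ cubeSum n h₀
  S₀≤ = ∑-flip-≤ x (lookup x) h₀
  double : ∀ a b → a + (a + 2 * b) ≡ 2 * (a + b)
  double = solve-∀

∑⊕₀₁₁-≤ : ∀ {n} (x : Vec Bool n) h → ∑⊕₀₁₁ x h ≤ 2 * cubeSum n h
∑⊕₀₁₁-≤ []          h = z≤n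
∑⊕₀₁₁-≤ {suc n} (false ∷ x) h = ≤-trans
  (+-mono-≤ (∑⊕₁₁-≤ x (h ∘ (true ∷_))) (∑⊕₀₁₁-≤ x (h ∘ (false ∷_))))
  (≤-reflexive (regroup (cubeSum n (h ∘ (true ∷_))) (cubeSum n (h ∘ (false ∷_)))))
  where
  regroup : ∀ a b → 2 * a + 2 * b ≡ 2 * (b + a)
  regroup = solve-∀
∑⊕₀₁₁-≤ {suc n} (true ∷ x) h = begin
  ∑[ r < n ] 𝟙[ zero-at r ]· (T₀ r + ∑[ p < n ] 𝟙[ lookup x p ]· (h₀ (x ⊕ r ⊕ p) + _))
    ≡⟨ ∑-𝟙[]·-distrib-+ zero-at T₀ _ ⟩
  ∑⊕₀₁ x h₀ + ∑[ r < n ] 𝟙[ zero-at r ]· (∑[ p < n ] 𝟙[ lookup x p ]· (h₀ (x ⊕ r ⊕ p) + _))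
    ≡⟨ cong (_+_ (∑⊕₀₁ x h₀)) (trans
         (sum-cong-≗ (λ r → cong 𝟙[ zero-at r ]·_ (∑-𝟙[]·-distrib-+ (lookup x) _ _)))
         (∑-𝟙[]·-distrib-+ zero-at _ _)) ⟩
  ∑⊕₀₁ x h₀ + (∑⊕₀₁ x h₀ + ∑⊕₀₁₁ x h₁)
    ≤⟨ +-mono-≤ (∑⊕₀₁-≤ x h₀) (+-mono-≤ (∑⊕₀₁-≤ x h₀) (∑⊕₀₁₁-≤ x h₁)) ⟩
  cubeSum n h₀ + (cubeSum n h₀ + 2 * cubeSum n h₁)
    ≡⟨ double (cubeSum n h₀) (cubeSum n h₁) ⟩
  2 * (cubeSum n h₀ + cubeSum n h₁) ∎
  where
  open ≤-Reasoning
  h₀ h₁ : Vec Bool n → ℕ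
  h₀ = h ∘ (false ∷_)
  h₁ = h ∘ (true ∷_)
  zero-at : Fin n → Bool
  zero-at r = not (lookup x r)
  T₀ : Fin n → ℕ
  T₀ r = ∑[ q < n ] 𝟙[ lookup x q ]· h₀ (x ⊕ r ⊕ q)
  double : ∀ a b → a + (a + 2 * b) ≡ 2 * (a + b)
  double = solve-∀

cubelet : ∀ {n} → Vec Bool n → Fin n → Fin n → Fin n → ℕ → ℕ
cubelet x r p q m = 𝟙[ not (lookup x r) ]· 𝟙[ lookup x p ]· 𝟙[ not (does (p ≟ q)) ]· 𝟙[ lookup x q ]· m

∑⊕₀₁₁-flat : ∀ {n} (x : Vec Bool n) h →
  ∑⊕₀₁₁ x h ≡ ∑³ (λ r p q → cubelet x r p q (h (x ⊕ r ⊕ p ⊕ q)))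
∑⊕₀₁₁-flat {n} x h = sum-cong-≗ (λ r →
  trans (sym (∑-guard {n} (not (lookup x r)) (λ p → 𝟙[ lookup x p ]· sum (term r p))))
  (sum-cong-≗ (λ p → trans (cong 𝟙[ not (lookup x r) ]·_ (sym (∑-guard {n} (lookup x p) (term r p))))
    (sym (∑-guard {n} (not (lookup x r)) (λ q → 𝟙[ lookup x p ]· term r p q))))))
  where
  term : Fin n → Fin n → Fin n → ℕ
  term r p q = 𝟙[ not (does (p ≟ q)) ]· 𝟙[ lookup x q ]· h (x ⊕ r ⊕ p ⊕ q)

∑⊕₀₁₁-count : ∀ {n m} (x : Vec Bool n) → ones x ≡ suc m →
  ∑⊕₀₁₁ x (λ _ → 1) ≡ (n ∸ suc m) * (suc m * m)
∑⊕₀₁₁-count {n} {m} x ones≡ = begin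
  ∑[ r < n ] 𝟙[ not (lookup x r) ]· (∑[ p < n ] 𝟙[ lookup x p ]· others p)
    ≡⟨ sum-cong-≗ (λ r → cong 𝟙[ not (lookup x r) ]·_
         (sum-cong-≗ (λ p → 𝟙[]·-cong (lookup x p) (others≡ p)))) ⟩
  ∑[ r < n ] 𝟙[ not (lookup x r) ]· (∑[ p < n ] 𝟙[ lookup x p ]· m)
    ≡⟨ sum-cong-≗ (λ r → cong 𝟙[ not (lookup x r) ]·_
         (trans (∑-𝟙[]·-const (lookup x) m) (cong (_* m) (trans (∑-ones x) ones≡)))) ⟩
  ∑[ r < n ] 𝟙[ not (lookup x r) ]· (suc m * m)
    ≡⟨ trans (∑-𝟙[]·-const (λ r → not (lookup x r)) _) (cong (_* (suc m * m)) zeros≡) ⟩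
  (n ∸ suc m) * (suc m * m) ∎
  where
  open ≡-Reasoning
  others : Fin n → ℕ
  others p = ∑[ q < n ] 𝟙[ not (does (p ≟ q)) ]· 𝟙 (lookup x q)
  others≡ : ∀ p → lookup x p ≡ true → others p ≡ m
  others≡ p xₚ = suc-injective (begin
    suc (others p)            ≡⟨ cong (λ b → 𝟙 b + others p) xₚ ⟨
    𝟙 (lookup x p) + others p ≡⟨ ∑-split-at p (𝟙 ∘ lookup x) ⟨
    ∑[ q < n ] 𝟙 (lookup x q) ≡⟨ trans (∑-ones x) ones≡ ⟩
    suc m                     ∎)
  zeros = ∑[ r < n ] 𝟙 (not (lookup x r))
  zeros≡ : zeros ≡ n ∸ suc m
  zeros≡ = trans (sym (m+n∸n≡m zeros (suc m)))
    (cong (_∸ suc m) (trans (cong (_+_ zeros) (sym ones≡)) (∑-zeros+ones x)))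

record Cubelet {n} (x : Vec Bool n) (r p q : Fin n) : Set where
  field
    zero-r : lookup x r ≡ false
    one-p  : lookup x p ≡ true
    one-q  : lookup x q ≡ true
    p≢q    : p ≢ q

  r≢p : r ≢ p
  r≢p refl with () ← trans (sym zero-r) one-p

  r≢q : r ≢ q
  r≢q refl with () ← trans (sym zero-r) one-q

  one-r⁺ : lookup (x ⊕ r) r ≡ true
  one-r⁺ = trans (lookup-⊕ x r) (cong not zero-r)

  one-p⁺ : lookup (x ⊕ r) p ≡ true
  one-p⁺ = trans (lookup-⊕-≢ x (≢-sym r≢p)) one-p

  one-q⁺ : lookup (x ⊕ r) q ≡ true
  one-q⁺ = trans (lookup-⊕-≢ x (≢-sym r≢q)) one-q

cubelet-weight : ∀ {n} {x : Vec Bool n} {r p q} → Cubelet x r p q → ∀ m → cubelet x r p q m ≡ m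
cubelet-weight {p = p} {q} c m
  rewrite Cubelet.zero-r c | Cubelet.one-p c | dec-false (p ≟ q) (Cubelet.p≢q c) | Cubelet.one-q c = refl

Cubelet-rotate₁ : ∀ {n} {x : Vec Bool n} {r p q} → Cubelet x r p q → Cubelet (x ⊕ r ⊕ q) q r p
Cubelet-rotate₁ {x = x} {r} {p} {q} c = record
  { zero-r = trans (lookup-⊕ (x ⊕ r) q) (cong not one-q⁺)
  ; one-p  = trans (lookup-⊕-≢ (x ⊕ r) r≢q) one-r⁺
  ; one-q  = trans (lookup-⊕-≢ (x ⊕ r) p≢q) one-p⁺
  ; p≢q    = r≢p }
  where open Cubelet c

Cubelet-rotate₂ : ∀ {n} {x : Vec Bool n} {r p q} → Cubelet x r p q → Cubelet (x ⊕ r ⊕ p) p q r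
Cubelet-rotate₂ {x = x} {r} {p} {q} c = record
  { zero-r = trans (lookup-⊕ (x ⊕ r) p) (cong not one-p⁺)
  ; one-p  = trans (lookup-⊕-≢ (x ⊕ r) (≢-sym p≢q)) one-q⁺
  ; one-q  = trans (lookup-⊕-≢ (x ⊕ r) r≢p) one-r⁺
  ; p≢q    = ≢-sym r≢q }
  where open Cubelet c

-- The Karchmer–Wigderson protocol of a formula

Leaf : ∀ {n} → Formula n → Set
Leaf G = Fin (size G)

labels : ∀ {n} (G : Formula n) → Vec (Fin n) (size G)
labels (pos i)   = i ∷ []
labels (neg i)   = i ∷ []
labels (and g h) = labels g ++ labels h
labels (or g h)  = labels g ++ labels h

label : ∀ {n} (G : Formula n) → Leaf G → Fin n
label G = lookup (labels G)

-- For x ∈ G⁻¹(1) and y ∈ G⁻¹(0), descend into a conjunct falsified by y or a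
-- disjunct satisfied by x; the invariant survives down to a leaf.
route : ∀ {n} (G : Formula n) → Vec Bool n → Vec Bool n → Leaf G
route (pos _)   x y = zero
route (neg _)   x y = zero
route (and g h) x y = if eval g y then size g ↑ʳ route h x y else route g x y ↑ˡ size h
route (or g h)  x y = if eval g x then route g x y ↑ˡ size h else size g ↑ʳ route h x y

↑ˡ≢↑ʳ : ∀ {m n} (i : Fin m) (j : Fin n) → i ↑ˡ n ≢ m ↑ʳ j
↑ˡ≢↑ʳ {m} {n} i j eq with () ← trans (sym (splitAt-↑ˡ m i n)) (trans (cong (splitAt m) eq) (splitAt-↑ʳ m n j))

route-rectangle : ∀ {n} (G : Formula n) {x y x′ y′} → route G x y ≡ route G x′ y′ → route G x y′ ≡ route G x y
route-rectangle (pos _) _ = refl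
route-rectangle (neg _) _ = refl
route-rectangle (and g h) {y = y} {y′ = y′} eq with eval g y | eval g y′
... | true  | true  = cong (size g ↑ʳ_) (route-rectangle h (↑ʳ-injective (size g) _ _ eq))
... | false | false = cong (_↑ˡ size h) (route-rectangle g (↑ˡ-injective (size h) _ _ eq))
... | true  | false = ⊥-elim (↑ˡ≢↑ʳ _ _ (sym eq))
... | false | true  = ⊥-elim (↑ˡ≢↑ʳ _ _ eq)
route-rectangle (or g h) {x} {x′ = x′} eq with eval g x | eval g x′
... | true  | true  = cong (_↑ˡ size h) (route-rectangle g (↑ˡ-injective (size h) _ _ eq))
... | false | false = cong (size g ↑ʳ_) (route-rectangle h (↑ʳ-injective (size g) _ _ eq))
... | true  | false = ⊥-elim (↑ˡ≢↑ʳ _ _ eq)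
... | false | true  = ⊥-elim (↑ˡ≢↑ʳ _ _ (sym eq))

DifferAt : ∀ {n} → Vec Bool n → Vec Bool n → Fin n → Set
DifferAt x y i = lookup x i ≢ lookup y i

route-separates : ∀ {n} (G : Formula n) {x y} → eval G x ≡ true → eval G y ≡ false →
  DifferAt x y (label G (route G x y))
route-separates (pos i) {x} {y} _ _ with lookup x i | lookup y i
... | true | false = λ ()
route-separates (neg i) {x} {y} _ _ with lookup x i | lookup y i
... | false | true = λ ()
route-separates (and g h) {x} {y} x⊨ y⊭ with eval g x in g-x | eval g y in g-y
... | true | true  = subst (DifferAt x y) (sym (lookup-++ʳ (labels g) (labels h) _)) (route-separates h x⊨ y⊭)
... | true | false = subst (DifferAt x y) (sym (lookup-++ˡ (labels g) (labels h) _)) (route-separates g g-x g-y)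
route-separates (and g h) () _ | false | _
route-separates (or g h) {x} {y} x⊨ y⊭ with eval g x in g-x | eval g y in g-y
... | true  | false = subst (DifferAt x y) (sym (lookup-++ˡ (labels g) (labels h) _)) (route-separates g g-x g-y)
... | false | false = subst (DifferAt x y) (sym (lookup-++ʳ (labels g) (labels h) _)) (route-separates h x⊨ y⊭)
route-separates (or g h) _ () | _ | true

route-edge-label : ∀ {n} (G : Formula n) {x} j → eval G x ≡ true → eval G (x ⊕ j) ≡ false →
  label G (route G x (x ⊕ j)) ≡ j
route-edge-label G {x} j x⊨ x⊕j⊭ with label G (route G x (x ⊕ j)) ≟ j
... | yes i≡j = i≡j
... | no  i≢j = ⊥-elim (route-separates G x⊨ x⊕j⊭ (sym (lookup-⊕-≢ x i≢j)))

-- Counting for a formula that separates two adjacent levels of the cube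

module Separating {n : ℕ} (k : ℕ) {F : Formula n}
  (F-upper : ∀ x → atLevel (suc k) x ≡ true → eval F x ≡ true)
  (F-lower : ∀ x → atLevel k x ≡ true → eval F x ≡ false) where

  A B : Vec Bool n → Bool
  A = atLevel (suc k)
  B = atLevel k

  R : Vec Bool n → Vec Bool n → Leaf F
  R = route F

  L : Vec Bool n → Vec Bool n → Fin n
  L x y = label F (R x y)

  edgeAt : Leaf F → Vec Bool n → Fin n → Bool
  edgeAt ℓ x i = A x ∧ lookup x i ∧ does (R x (x ⊕ i) ≟ ℓ)

  edges : Leaf F → ℕ
  edges ℓ = ∑[ x ∈𝔹^ n ] ∑[ i < n ] 𝟙 (edgeAt ℓ x i)

  boundary : ℕ
  boundary = ∑[ x ∈𝔹^ n ] ∑[ i < n ] 𝟙 (A x ∧ lookup x i)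

  edgeAt⇒ : ∀ {ℓ} x i → edgeAt ℓ x i ≡ true → A x ≡ true × lookup x i ≡ true × R x (x ⊕ i) ≡ ℓ
  edgeAt⇒ {ℓ} x i e with A x | lookup x i | R x (x ⊕ i) ≟ ℓ
  ... | true | true | yes x→ℓ = refl , refl , x→ℓ

  edge-label : ∀ {ℓ} x i → edgeAt ℓ x i ≡ true → label F ℓ ≡ i
  edge-label x i e with ax , xᵢ , x→ℓ ← edgeAt⇒ x i e =
    subst (λ ℓ′ → label F ℓ′ ≡ i) x→ℓ
      (route-edge-label F i (F-upper x ax) (F-lower (x ⊕ i) (atLevel-⊕-true x xᵢ ax)))

  ∑-edges : ∑[ ℓ < size F ] edges ℓ ≡ boundary
  ∑-edges = begin
    ∑[ ℓ < size F ] edges ℓ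
      ≡⟨ ∑-cubeSum-comm (λ ℓ x → ∑[ i < n ] 𝟙 (edgeAt ℓ x i)) ⟩
    ∑[ x ∈𝔹^ n ] ∑[ ℓ < size F ] ∑[ i < n ] 𝟙 (edgeAt ℓ x i)
      ≡⟨ cubeSum-cong {n} (λ x → ∑-comm (λ ℓ i → 𝟙 (edgeAt ℓ x i))) ⟩
    ∑[ x ∈𝔹^ n ] ∑[ i < n ] ∑[ ℓ < size F ] 𝟙 (edgeAt ℓ x i)
      ≡⟨ cubeSum-cong {n} (λ x → sum-cong-≗ (one-leaf x)) ⟩
    boundary ∎
    where
    open ≡-Reasoning
    one-leaf : ∀ x i → ∑[ ℓ < size F ] 𝟙 (edgeAt ℓ x i) ≡ 𝟙 (A x ∧ lookup x i)
    one-leaf x i with A x | lookup x i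
    ... | true  | true  = ∑-delta (R x (x ⊕ i)) (λ _ → 1)
    ... | true  | false = sum-replicate-zero (size F)
    ... | false | _     = sum-replicate-zero (size F)

  boundary≡ : boundary ≡ levelSize n (suc k) * suc k
  boundary≡ = trans (cubeSum-cong {n} degree) (sym (*-distribʳ-cubeSum (suc k) (𝟙 ∘ A)))
    where
    degree : ∀ x → ∑[ i < n ] 𝟙 (A x ∧ lookup x i) ≡ 𝟙 (A x) * suc k
    degree x with A x in ax
    ... | true  = trans (∑-ones x) (trans (atLevel⇒ones≡ x ax) (sym (*-identityˡ (suc k))))
    ... | false = sum-replicate-zero n

  goodAt : Leaf F → Vec Bool n → Vec Bool n → Bool
  goodAt ℓ x y = lookup x i ∧ not (lookup y i) ∧ does (R x (x ⊕ i) ≟ ℓ) ∧ does (R (y ⊕ i) y ≟ ℓ)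
    where
    i : Fin n
    i = label F ℓ

  good : Vec Bool n → Vec Bool n → Bool
  good x y = goodAt (R x y) x y

  goodPair badPair : Vec Bool n → Vec Bool n → Bool
  goodPair x y = A x ∧ B y ∧ good x y
  badPair  x y = A x ∧ B y ∧ not (good x y)

  goodPairs badPairs : ℕ
  goodPairs = ∑[ x ∈𝔹^ n ] ∑[ y ∈𝔹^ n ] 𝟙 (goodPair x y)
  badPairs  = ∑[ x ∈𝔹^ n ] ∑[ y ∈𝔹^ n ] 𝟙 (badPair x y)

  goodPairs+badPairs : goodPairs + badPairs ≡ levelSize n (suc k) * levelSize n k
  goodPairs+badPairs = begin
    goodPairs + badPairs
      ≡⟨ cubeSum-distrib-+ (λ x → ∑[ y ∈𝔹^ n ] 𝟙 (goodPair x y)) _ ⟨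
    ∑[ x ∈𝔹^ n ] (∑[ y ∈𝔹^ n ] 𝟙 (goodPair x y) + ∑[ y ∈𝔹^ n ] 𝟙 (badPair x y))
      ≡⟨ cubeSum-cong {n} (λ x → cubeSum-distrib-+ (λ y → 𝟙 (goodPair x y)) _) ⟨
    ∑[ x ∈𝔹^ n ] ∑[ y ∈𝔹^ n ] (𝟙 (goodPair x y) + 𝟙 (badPair x y))
      ≡⟨ cubeSum-cong {n} (λ x → cubeSum-cong {n} (split x)) ⟩
    ∑[ x ∈𝔹^ n ] ∑[ y ∈𝔹^ n ] (𝟙 (A x) * 𝟙 (B y))
      ≡⟨ cubeSum-* (𝟙 ∘ A) (𝟙 ∘ B) ⟨
    levelSize n (suc k) * levelSize n k ∎
    where
    open ≡-Reasoning
    split : ∀ x y → 𝟙 (goodPair x y) + 𝟙 (badPair x y) ≡ 𝟙 (A x) * 𝟙 (B y)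
    split x y with A x | B y | good x y
    ... | true  | true  | true  = refl
    ... | true  | true  | false = refl
    ... | true  | false | _     = refl
    ... | false | _     | _     = refl

  edge-pair : ∀ {ℓ} x y i j → edgeAt ℓ x i ≡ true → edgeAt ℓ (y ⊕ j) j ≡ true →
    R x y ≡ ℓ × label F ℓ ≡ i × label F ℓ ≡ j × goodPair x y ≡ true
  edge-pair {ℓ} x y i j e₁ e₂
    with edge-label x i e₁ | edge-label (y ⊕ j) j e₂ | edgeAt⇒ x i e₁ | edgeAt⇒ (y ⊕ j) j e₂
  ... | refl | refl | ax , xᵢ , x→ℓ | ay⊕i , [y⊕i]ᵢ , y⊕i→ℓ =
    x→y , refl , refl , ∧-intro ax (∧-intro by (subst (λ ℓ′ → goodAt ℓ′ x y ≡ true) (sym x→y)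
      (∧-intro xᵢ (∧-intro (cong not yᵢ)
        (∧-intro (dec-true (R x (x ⊕ i) ≟ ℓ) x→ℓ) (dec-true (R (y ⊕ i) y ≟ ℓ) y⊕i→y))))))
    where
    y⊕i→y : R (y ⊕ i) y ≡ ℓ
    y⊕i→y = subst (λ w → R (y ⊕ i) w ≡ ℓ) (⊕-involutive y i) y⊕i→ℓ
    by : B y ≡ true
    by = subst (λ w → B w ≡ true) (⊕-involutive y i) (atLevel-⊕-true (y ⊕ i) [y⊕i]ᵢ ay⊕i)
    yᵢ : lookup y i ≡ false
    yᵢ = trans (sym (not-involutive _)) (cong not (trans (sym (lookup-⊕ y i)) [y⊕i]ᵢ))
    x→y : R x y ≡ ℓ
    x→y = trans (route-rectangle F (trans x→ℓ (sym y⊕i→y))) x→ℓ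

  edge-pair-term : ∀ ℓ x y i j →
    𝟙 (edgeAt ℓ x i) * 𝟙 (edgeAt ℓ (y ⊕ j) j)
      ≤ 𝟙[ does (R x y ≟ ℓ) ]· 𝟙[ does (label F ℓ ≟ i) ]· 𝟙[ does (label F ℓ ≟ j) ]· 𝟙 (goodPair x y)
  edge-pair-term ℓ x y i j with edgeAt ℓ x i in e₁ | edgeAt ℓ (y ⊕ j) j in e₂
  ... | false | _     = z≤n
  ... | true  | false = z≤n
  ... | true  | true  with x→y , ℓ→i , ℓ→j , g ← edge-pair x y i j e₁ e₂
    rewrite dec-true (R x y ≟ ℓ) x→y | dec-true (label F ℓ ≟ i) ℓ→i | dec-true (label F ℓ ≟ j) ℓ→j =
      ≤-reflexive (cong 𝟙 (sym g))

  edge-pairs≤goodPair : ∀ x y →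
    ∑[ ℓ < size F ] ∑[ i < n ] ∑[ j < n ] (𝟙 (edgeAt ℓ x i) * 𝟙 (edgeAt ℓ (y ⊕ j) j)) ≤ 𝟙 (goodPair x y)
  edge-pairs≤goodPair x y = ≤-trans
    (∑-mono-≤ (λ ℓ → ∑-mono-≤ (λ i → ∑-mono-≤ (λ j → edge-pair-term ℓ x y i j))))
    (≤-reflexive (trans (sum-cong-≗ (λ ℓ → trans (sum-cong-≗ (collapse-j ℓ)) (collapse-i ℓ))) collapse-ℓ))
    where
    g = 𝟙 (goodPair x y)
    at : Leaf F → Bool
    at ℓ = does (R x y ≟ ℓ)
    collapse-j : ∀ ℓ i →
      ∑[ j < n ] 𝟙[ at ℓ ]· 𝟙[ does (label F ℓ ≟ i) ]· 𝟙[ does (label F ℓ ≟ j) ]· g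
        ≡ 𝟙[ at ℓ ]· 𝟙[ does (label F ℓ ≟ i) ]· g
    collapse-j ℓ i = trans (∑-guard {n} (at ℓ) _) (cong 𝟙[ at ℓ ]·_
      (trans (∑-guard {n} (does (label F ℓ ≟ i)) (λ j → 𝟙[ does (label F ℓ ≟ j) ]· g))
             (cong 𝟙[ does (label F ℓ ≟ i) ]·_ (∑-delta (label F ℓ) (λ _ → g)))))
    collapse-i : ∀ ℓ → ∑[ i < n ] 𝟙[ at ℓ ]· 𝟙[ does (label F ℓ ≟ i) ]· g ≡ 𝟙[ at ℓ ]· g
    collapse-i ℓ = trans (∑-guard {n} (at ℓ) (λ i → 𝟙[ does (label F ℓ ≟ i) ]· g))
      (cong 𝟙[ at ℓ ]·_ (∑-delta (label F ℓ) (λ _ → g)))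
    collapse-ℓ : ∑[ ℓ < size F ] 𝟙[ at ℓ ]· g ≡ g
    collapse-ℓ = ∑-delta (R x y) (λ _ → g)

  ∑-edges²≤goodPairs : ∑[ ℓ < size F ] (edges ℓ * edges ℓ) ≤ goodPairs
  ∑-edges²≤goodPairs = begin
    ∑[ ℓ < size F ] (edges ℓ * edges ℓ)
      ≡⟨ sum-cong-≗ edges² ⟩
    ∑[ ℓ < size F ] ∑[ x ∈𝔹^ n ] ∑[ y ∈𝔹^ n ] pairs ℓ x y
      ≡⟨ ∑-cubeSum-comm (λ ℓ x → ∑[ y ∈𝔹^ n ] pairs ℓ x y) ⟩
    ∑[ x ∈𝔹^ n ] ∑[ ℓ < size F ] ∑[ y ∈𝔹^ n ] pairs ℓ x y
      ≡⟨ cubeSum-cong {n} (λ x → ∑-cubeSum-comm (λ ℓ y → pairs ℓ x y)) ⟩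
    ∑[ x ∈𝔹^ n ] ∑[ y ∈𝔹^ n ] ∑[ ℓ < size F ] pairs ℓ x y
      ≤⟨ cubeSum-mono-≤ {n} (λ x → cubeSum-mono-≤ {n} (edge-pairs≤goodPair x)) ⟩
    goodPairs ∎
    where
    open ≤-Reasoning
    pairs : Leaf F → Vec Bool n → Vec Bool n → ℕ
    pairs ℓ x y = ∑[ i < n ] ∑[ j < n ] (𝟙 (edgeAt ℓ x i) * 𝟙 (edgeAt ℓ (y ⊕ j) j))
    edges² : ∀ ℓ → edges ℓ * edges ℓ ≡ ∑[ x ∈𝔹^ n ] ∑[ y ∈𝔹^ n ] pairs ℓ x y
    edges² ℓ = trans (cong (edges ℓ *_) (cubeSum-∑-⊕ (λ y j → 𝟙 (edgeAt ℓ y j))))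
      (cubeSum-∑-* (λ x i → 𝟙 (edgeAt ℓ x i)) (λ y j → 𝟙 (edgeAt ℓ (y ⊕ j) j)))

  boundary²≤size*goodPairs : boundary * boundary ≤ size F * goodPairs
  boundary²≤size*goodPairs = begin
    boundary * boundary                          ≡⟨ cong₂ _*_ ∑-edges ∑-edges ⟨
    sum edges * sum edges                        ≤⟨ ∑²≤n*∑² edges ⟩
    size F * ∑[ ℓ < size F ] (edges ℓ * edges ℓ) ≤⟨ *-monoʳ-≤ (size F) ∑-edges²≤goodPairs ⟩
    size F * goodPairs                           ∎
    where open ≤-Reasoning

  goodAt⇒ : ∀ ℓ u v → goodAt ℓ u v ≡ true →
    let i = label F ℓ in lookup u i ≡ true × lookup v i ≡ false × R u (u ⊕ i) ≡ ℓ × R (v ⊕ i) v ≡ ℓ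
  goodAt⇒ ℓ u v g with lookup u (label F ℓ) | lookup v (label F ℓ)
                     | R u (u ⊕ label F ℓ) ≟ ℓ | R (v ⊕ label F ℓ) v ≟ ℓ
  ... | true | false | yes u→ℓ | yes v→ℓ = refl , refl , u→ℓ , v→ℓ

  good-swap : ∀ u v → good u v ≡ true →
    let i = L u v in lookup u i ≡ true × lookup v i ≡ false × L (v ⊕ i) (u ⊕ i) ≡ i
  good-swap u v g with uᵢ , vᵢ , u→ℓ , v→ℓ ← goodAt⇒ (R u v) u v g =
    uᵢ , vᵢ , cong (label F) (trans (route-rectangle F (trans v→ℓ (sym u→ℓ))) v→ℓ)

  -- Below a point y with ones at a, b, c lie the pairs (y⊕a, y⊕b⊕c),
  -- (y⊕b, y⊕c⊕a), (y⊕c, y⊕a⊕b); good-swap sends a good one to another of them.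
  pair-label : ∀ y a b c → lookup y a ≡ true → good (y ⊕ a) (y ⊕ b ⊕ c) ≡ true →
      (L (y ⊕ a) (y ⊕ b ⊕ c) ≡ b × L (y ⊕ c) (y ⊕ a ⊕ b) ≡ b)
    ⊎ (L (y ⊕ a) (y ⊕ b ⊕ c) ≡ c × L (y ⊕ b) (y ⊕ c ⊕ a) ≡ c)
  pair-label y a b c ya g with uᵢ , vᵢ , swapped ← good-swap (y ⊕ a) (y ⊕ b ⊕ c) g
                             | L (y ⊕ a) (y ⊕ b ⊕ c) ≟ b | L (y ⊕ a) (y ⊕ b ⊕ c) ≟ c
  ... | yes i≡b | _ = inj₁ (i≡b , subst (λ w → L w (y ⊕ a ⊕ b) ≡ b) (⊕-cancel-middle y b c)
                                   (subst (λ j → L (y ⊕ b ⊕ c ⊕ j) (y ⊕ a ⊕ j) ≡ j) i≡b swapped))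
  ... | no _ | yes i≡c = inj₂ (i≡c , subst₂ (λ w w′ → L w w′ ≡ c) (⊕-involutive (y ⊕ b) c) (⊕-comm y a c)
                                      (subst (λ j → L (y ⊕ b ⊕ c ⊕ j) (y ⊕ a ⊕ j) ≡ j) i≡c swapped))
  ... | no i≢b | no i≢c = ⊥-elim (only-flip-a (L (y ⊕ a) (y ⊕ b ⊕ c) ≟ a))
    where
    i = L (y ⊕ a) (y ⊕ b ⊕ c)
    only-flip-a : Dec (i ≡ a) → ⊥
    only-flip-a (yes i≡a) with () ←
      trans (sym (subst (λ j → lookup (y ⊕ a) j ≡ true) i≡a uᵢ)) (trans (lookup-⊕ y a) (cong not ya))
    only-flip-a (no i≢a) with () ← trans (sym uᵢ) (trans (lookup-⊕-≢ y i≢a)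
      (trans (sym (lookup-⊕-≢ y i≢b)) (trans (sym (lookup-⊕-≢ (y ⊕ b) i≢c)) vᵢ)))

  no-good-triangle : ∀ y a b c → lookup y a ≡ true → lookup y b ≡ true → lookup y c ≡ true →
    a ≢ b → b ≢ c → c ≢ a →
    good (y ⊕ a) (y ⊕ b ⊕ c) ≡ true → good (y ⊕ b) (y ⊕ c ⊕ a) ≡ true →
    good (y ⊕ c) (y ⊕ a ⊕ b) ≡ true → ⊥
  no-good-triangle y a b c ya yb yc a≢b b≢c c≢a ga gb gc
    with pair-label y a b c ya ga | pair-label y b c a yb gb | pair-label y c a b yc gc
  ... | inj₁ (La≡b , _) | inj₁ (_ , La≡c) | _               = b≢c (trans (sym La≡b) La≡c)
  ... | inj₁ (_ , Lc≡b) | inj₂ (_ , Lc≡a) | _               = a≢b (trans (sym Lc≡a) Lc≡b)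
  ... | inj₂ (_ , Lb≡c) | _               | inj₁ (_ , Lb≡a) = c≢a (trans (sym Lb≡c) Lb≡a)
  ... | inj₂ (La≡c , _) | _               | inj₂ (_ , La≡b) = b≢c (trans (sym La≡b) La≡c)

  no-good-cubelet : ∀ {x r p q} → Cubelet x r p q →
    good x (x ⊕ r ⊕ p ⊕ q) ≡ true → good (x ⊕ r ⊕ q) (x ⊕ p) ≡ true →
    good (x ⊕ r ⊕ p) (x ⊕ q) ≡ true → ⊥
  no-good-cubelet {x} {r} {p} {q} c g₁ g₂ g₃ =
    no-good-triangle (x ⊕ r) r p q one-r⁺ one-p⁺ one-q⁺ r≢p p≢q (≢-sym r≢q)
      (subst (λ w → good w (x ⊕ r ⊕ p ⊕ q) ≡ true) (sym (⊕-involutive x r)) g₁)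
      (subst (λ w → good (x ⊕ r ⊕ p) w ≡ true) (sym (⊕-cancel-middle x r q)) g₃)
      (subst (λ w → good (x ⊕ r ⊕ q) w ≡ true) (sym (cong (_⊕ p) (⊕-involutive x r))) g₂)
    where open Cubelet c

  badPair≡ : ∀ u v → A u ≡ true → B v ≡ true → badPair u v ≡ not (good u v)
  badPair≡ u v au bv = cong₂ (λ a b → a ∧ b ∧ not (good u v)) au bv

  one-bad-pair : ∀ {x r p q} → A x ≡ true → Cubelet x r p q →
    1 ≤ 𝟙 (badPair x (x ⊕ r ⊕ p ⊕ q)) + 𝟙 (badPair (x ⊕ r ⊕ q) (x ⊕ p)) + 𝟙 (badPair (x ⊕ r ⊕ p) (x ⊕ q))
  one-bad-pair {x} {r} {p} {q} ax c = subst (1 ≤_) (sym (cong₂ _+_ (cong₂ _+_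
      (cong 𝟙 (badPair≡ x (x ⊕ r ⊕ p ⊕ q) ax
        (atLevel-⊕-true (x ⊕ r ⊕ p) (Cubelet.one-p (Cubelet-rotate₂ c)) ax⊕r⊕p)))
      (cong 𝟙 (badPair≡ (x ⊕ r ⊕ q) (x ⊕ p) (atLevel-⊕-true (x ⊕ r) one-q⁺ ax⊕r) (atLevel-⊕-true x one-p ax))))
      (cong 𝟙 (badPair≡ (x ⊕ r ⊕ p) (x ⊕ q) ax⊕r⊕p (atLevel-⊕-true x one-q ax)))))
    (at-least-one-false (no-good-cubelet c))
    where
    open Cubelet c
    ax⊕r : atLevel (suc (suc k)) (x ⊕ r) ≡ true
    ax⊕r = atLevel-⊕-false x zero-r ax
    ax⊕r⊕p : A (x ⊕ r ⊕ p) ≡ true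
    ax⊕r⊕p = atLevel-⊕-true (x ⊕ r) one-p⁺ ax⊕r

  badAt : Vec Bool n → Fin n → Fin n → Fin n → ℕ
  badAt x r p q = cubelet x r p q (𝟙 (badPair x (x ⊕ r ⊕ p ⊕ q)))

  badAt₂ badAt₃ : Vec Bool n → Fin n → Fin n → Fin n → ℕ
  badAt₂ x r p q = badAt (x ⊕ r ⊕ q) q r p
  badAt₃ x r p q = badAt (x ⊕ r ⊕ p) p q r

  cubelet-or-zero : ∀ x r p q → 𝟙[ A x ]· cubelet x r p q 1 ≡ 0 ⊎ A x ≡ true × Cubelet x r p q
  cubelet-or-zero x r p q with A x | lookup x r in xr | lookup x p in xp | p ≟ q | lookup x q in xq
  ... | false | _     | _     | _      | _     = inj₁ refl
  ... | true  | true  | _     | _      | _     = inj₁ refl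
  ... | true  | false | false | _      | _     = inj₁ refl
  ... | true  | false | true  | yes _  | _     = inj₁ refl
  ... | true  | false | true  | no _   | false = inj₁ refl
  ... | true  | false | true  | no p≢q | true  = inj₂ (refl , record { zero-r = xr ; one-p = xp ; one-q = xq ; p≢q = p≢q })

  cubelet-bound : ∀ x r p q → 𝟙[ A x ]· cubelet x r p q 1 ≤ badAt x r p q + badAt₂ x r p q + badAt₃ x r p q
  cubelet-bound x r p q with cubelet-or-zero x r p q
  ... | inj₁ ≡0       = ≤-trans (≤-reflexive ≡0) z≤n
  ... | inj₂ (ax , c) = subst₂ _≤_ (sym (trans (cong (λ b → 𝟙[ b ]· cubelet x r p q 1) ax) (cubelet-weight c 1)))
                                   (sym weights) (one-bad-pair ax c)
    where
    weights : badAt x r p q + badAt₂ x r p q + badAt₃ x r p q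
      ≡ 𝟙 (badPair x (x ⊕ r ⊕ p ⊕ q)) + 𝟙 (badPair (x ⊕ r ⊕ q) (x ⊕ p)) + 𝟙 (badPair (x ⊕ r ⊕ p) (x ⊕ q))
    weights = cong₂ _+_
      (cong₂ _+_ (cubelet-weight c _)
        (trans (cubelet-weight (Cubelet-rotate₁ c) _) (cong (𝟙 ∘ badPair (x ⊕ r ⊕ q))
          (trans (cong (λ w → w ⊕ r ⊕ p) (⊕-involutive (x ⊕ r) q)) (cong (_⊕ p) (⊕-involutive x r))))))
      (trans (cubelet-weight (Cubelet-rotate₂ c) _) (cong (𝟙 ∘ badPair (x ⊕ r ⊕ p))
        (trans (cong (λ w → w ⊕ q ⊕ r) (⊕-involutive (x ⊕ r) p)) (⊕-cancel-middle x r q))))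

  cubelets : ℕ
  cubelets = ∑[ x ∈𝔹^ n ] 𝟙[ A x ]· ∑⊕₀₁₁ x (λ _ → 1)

  cubelets≡ : cubelets ≡ levelSize n (suc k) * ((n ∸ suc k) * (suc k * k))
  cubelets≡ = trans (cubeSum-cong {n} count) (sym (*-distribʳ-cubeSum _ (𝟙 ∘ A)))
    where
    count : ∀ x → 𝟙[ A x ]· ∑⊕₀₁₁ x (λ _ → 1) ≡ 𝟙 (A x) * ((n ∸ suc k) * (suc k * k))
    count x = trans (𝟙[]·-cong (A x) (λ ax → ∑⊕₀₁₁-count x (atLevel⇒ones≡ x ax))) (𝟙[]·≡𝟙* (A x) _)

  ∑badAt≤2*badPairs : ∑[ x ∈𝔹^ n ] ∑³ (badAt x) ≤ 2 * badPairs
  ∑badAt≤2*badPairs = begin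
    ∑[ x ∈𝔹^ n ] ∑³ (badAt x)
      ≡⟨ cubeSum-cong {n} (λ x → ∑⊕₀₁₁-flat x (𝟙 ∘ badPair x)) ⟨
    ∑[ x ∈𝔹^ n ] ∑⊕₀₁₁ x (𝟙 ∘ badPair x)
      ≤⟨ cubeSum-mono-≤ {n} (λ x → ∑⊕₀₁₁-≤ x (𝟙 ∘ badPair x)) ⟩
    ∑[ x ∈𝔹^ n ] (2 * ∑[ y ∈𝔹^ n ] 𝟙 (badPair x y))
      ≡⟨ *-distribˡ-cubeSum 2 (λ x → ∑[ y ∈𝔹^ n ] 𝟙 (badPair x y)) ⟨
    2 * badPairs ∎
    where open ≤-Reasoning

  cubeSum-badAt-⊕⊕ : ∀ i j a b c → ∑[ x ∈𝔹^ n ] badAt (x ⊕ i ⊕ j) a b c ≡ ∑[ x ∈𝔹^ n ] badAt x a b c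
  cubeSum-badAt-⊕⊕ i j a b c = trans (cubeSum-⊕ (λ w → badAt (w ⊕ j) a b c) i) (cubeSum-⊕ (λ w → badAt w a b c) j)

  badAt₂-rotate : ∑[ x ∈𝔹^ n ] ∑³ (badAt₂ x) ≡ ∑[ x ∈𝔹^ n ] ∑³ (badAt x)
  badAt₂-rotate = trans (cubeSum-∑³-comm badAt₂)
    (trans (∑³-cong (λ r p q → cubeSum-badAt-⊕⊕ r q q r p))
    (trans (∑³-rotate (λ r p q → ∑[ x ∈𝔹^ n ] badAt x q r p)) (sym (cubeSum-∑³-comm badAt))))

  badAt₃-rotate : ∑[ x ∈𝔹^ n ] ∑³ (badAt₃ x) ≡ ∑[ x ∈𝔹^ n ] ∑³ (badAt x)
  badAt₃-rotate = trans (cubeSum-∑³-comm badAt₃)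
    (trans (∑³-cong (λ r p q → cubeSum-badAt-⊕⊕ r p p q r))
    (trans (sym (∑³-rotate (λ a b c → ∑[ x ∈𝔹^ n ] badAt x a b c))) (sym (cubeSum-∑³-comm badAt))))

  cubelets≤6*badPairs : cubelets ≤ 6 * badPairs
  cubelets≤6*badPairs = begin
    cubelets
      ≡⟨ cubeSum-cong {n} (λ x → trans (cong 𝟙[ A x ]·_ (∑⊕₀₁₁-flat x (λ _ → 1)))
                                        (𝟙[]·-∑³ (A x) (λ r p q → cubelet x r p q 1))) ⟩
    ∑[ x ∈𝔹^ n ] ∑³ (λ r p q → 𝟙[ A x ]· cubelet x r p q 1)
      ≤⟨ cubeSum-mono-≤ {n} (λ x → ∑³-mono-≤ (cubelet-bound x)) ⟩
    ∑[ x ∈𝔹^ n ] ∑³ (λ r p q → badAt x r p q + badAt₂ x r p q + badAt₃ x r p q)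
      ≡⟨ cubeSum-∑³-distrib-+ (λ x r p q → badAt x r p q + badAt₂ x r p q) badAt₃ ⟩
    ∑[ x ∈𝔹^ n ] ∑³ (λ r p q → badAt x r p q + badAt₂ x r p q) + ∑[ x ∈𝔹^ n ] ∑³ (badAt₃ x)
      ≡⟨ cong₂ _+_ (trans (cubeSum-∑³-distrib-+ badAt badAt₂) (cong (_+_ S) badAt₂-rotate)) badAt₃-rotate ⟩
    S + S + S
      ≤⟨ +-mono-≤ (+-mono-≤ ∑badAt≤2*badPairs ∑badAt≤2*badPairs) ∑badAt≤2*badPairs ⟩
    2 * badPairs + 2 * badPairs + 2 * badPairs
      ≡⟨ triple badPairs ⟩
    6 * badPairs ∎
    where
    open ≤-Reasoning
    S = ∑[ x ∈𝔹^ n ] ∑³ (badAt x)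
    triple : ∀ b → 2 * b + 2 * b + 2 * b ≡ 6 * b
    triple = solve-∀

  size-bound : 6 * (boundary * boundary) + size F * cubelets ≤ size F * (6 * (levelSize n (suc k) * levelSize n k))
  size-bound = begin
    6 * (boundary * boundary) + size F * cubelets
      ≤⟨ +-mono-≤ (*-monoʳ-≤ 6 boundary²≤size*goodPairs) (*-monoʳ-≤ (size F) cubelets≤6*badPairs) ⟩
    6 * (size F * goodPairs) + size F * (6 * badPairs)
      ≡⟨ regroup (size F) goodPairs badPairs ⟩
    size F * (6 * (goodPairs + badPairs))
      ≡⟨ cong (λ m → size F * (6 * m)) goodPairs+badPairs ⟩
    size F * (6 * (levelSize n (suc k) * levelSize n k)) ∎
    where
    open ≤-Reasoning
    regroup : ∀ t g b → 6 * (t * g) + t * (6 * b) ≡ t * (6 * (g + b))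
    regroup = solve-∀

MAJ-upper : ∀ l x → atLevel (suc l) x ≡ true → MAJ l x ≡ true
MAJ-upper l x at = dec-true (suc l ℕ.≤? ones x) (≤-reflexive (sym (atLevel⇒ones≡ x at)))

MAJ-lower : ∀ l x → atLevel l x ≡ true → MAJ l x ≡ false
MAJ-lower l x at = dec-false (suc l ℕ.≤? ones x) (λ l<ones → <-irrefl (sym (atLevel⇒ones≡ x at)) l<ones)

nCk>0 : ∀ n k → k ≤ n → 0 < n C k
nCk>0 n       zero    _         = s≤s z≤n
nCk>0 (suc n) (suc k) (s≤s k≤n) =
  ≤-trans (nCk>0 n k k≤n) (≤-trans (m≤m+n _ _) (≤-reflexive (nCk+nC[k+1]≡[n+1]C[k+1] n k)))

ℕ-bound⇒ℤ-bound : ∀ a t x y → a + t * y ≤ t * x → + a ≤ℤ + t *ℤ (+ x - + y)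
ℕ-bound⇒ℤ-bound a zero    x y a≤0   = +≤+ (≤-trans (m≤m+n a 0) a≤0)
ℕ-bound⇒ℤ-bound a (suc t) x y bound = subst (+ a ≤ℤ_) (sym eq) (+≤+ a≤)
  where
  y≤x : y ≤ x
  y≤x = *-cancelˡ-≤ (suc t) (m+n≤o⇒n≤o a bound)
  a≤ : a ≤ suc t * (x ∸ y)
  a≤ = subst (a ≤_) (sym (*-distribˡ-∸ (suc t) x y)) (m+n≤o⇒m≤o∸n a bound)
  eq : + suc t *ℤ (+ x - + y) ≡ + (suc t * (x ∸ y))
  eq = trans (cong (+ suc t *ℤ_) (trans ([+m]-[+n]≡m⊖n x y) (⊖-≥ y≤x))) (sym (pos-* (suc t) (x ∸ y)))

theorem4p1 : (l : ℕ) → 1 ≤ l → (F : Formula (suc (2 * l))) → Computes F (MAJ l) →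
    (+ (6 * (suc (2 * l) C l) * (suc l * suc l)))
      ≤ℤ (+ size F) *ℤ (+ (6 * (suc (2 * l) C l)) - + (l * l * suc l))
theorem4p1 l _ F F-maj =
  ℕ-bound⇒ℤ-bound _ (size F) _ _ (*-cancelˡ-≤ N {{N≢0}} (subst₂ _≤_ lhs rhs size-bound))
  where
  n N : ℕ
  n = suc (2 * l)
  N = n C l
  open Separating l {F} (λ x ax → trans (F-maj x) (MAJ-upper l x ax)) (λ x bx → trans (F-maj x) (MAJ-lower l x bx))
  N≢0 : NonZero N
  N≢0 = >-nonZero (nCk>0 n l (m≤n⇒m≤1+n (m≤m+n l (l + 0))))
  n∸[l+1]≡l : n ∸ suc l ≡ l
  n∸[l+1]≡l = trans (m+n∸m≡n l (l + 0)) (+-identityʳ l)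
  upper≡N : levelSize n (suc l) ≡ N
  upper≡N = trans (levelSize≡nCk n (suc l)) (trans (nCk≡nC[n∸k] (s≤s (m≤m+n l (l + 0)))) (cong (n C_) n∸[l+1]≡l))
  lhs : 6 * (boundary * boundary) + size F * cubelets ≡ N * (6 * N * (suc l * suc l) + size F * (l * l * suc l))
  lhs rewrite boundary≡ | cubelets≡ | upper≡N | n∸[l+1]≡l = regroup N (size F) l
    where
    regroup : ∀ N t l → 6 * ((N * suc l) * (N * suc l)) + t * (N * (l * (suc l * l)))
                      ≡ N * (6 * N * (suc l * suc l) + t * (l * l * suc l))
    regroup = solve-∀
  rhs : size F * (6 * (levelSize n (suc l) * levelSize n l)) ≡ N * (size F * (6 * N))
  rhs rewrite upper≡N | levelSize≡nCk n l = regroup N (size F)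
    where
    regroup : ∀ N t → t * (6 * (N * N)) ≡ N * (t * (6 * N))
    regroup = solve-∀
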